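{- For any types $A, B$ and any function $f : A \to B$, there are functions $\mathsf{ish2adj}\, f \to \mathsf{ish2adjl}\, f$ and $\mathsf{ish2adjl}\, f \to \mathsf{ish2adj}\, f$.
   Context: Work in homotopy type theory with univalence and function extensionality. For $f : A \to B$, $f[p]$ denotes $\mathsf{ap}_f\, p$ and $f\llbracket \alpha \rrbracket$ the action of $f$ on a 2-path $\alpha$. $f \sim g$ is $\prod_x fx = gx$. For a homotopy $H : f \sim g$: $H_h :\equiv \lambda c.\,H_{hc}$; $k[H] :\equiv \lambda a.\,k[H_a]$; for $\alpha : H \sim H'$, $k\llbracket\alpha\rrbracket :\equiv \lambda a.\, k\llbracket \alpha_a\rrbracket$. $H \cdot H'$ is pointwise concatenation in diagrammatic order. For $h : X \to Y$, $k : Y \to X$, $H : kh \sim \mathsf{id}_X$, $\mathsf{Coh}\, H : H_{kh} \sim k[h[H]]$ has component at $x$ the naturality path $H_{khx} = (kh)[H_x]$ followed by the functoriality path $(kh)[H_x] = k[h[H_x]]$. Definitions (with $g : B \to A$, $\eta : gf \sim \mathsf{id}_A$, $\varepsilon : fg \sim \mathsf{id}_B$): $\mathsf{ish2adj}\, f :\equiv \sum_{g, \eta, \varepsilon} \sum_{\tau : f[\eta] \sim \varepsilon_f} \sum_{\theta : \eta_g \sim g[\varepsilon]} (\mathsf{Coh}\, \eta \cdot g\llbracket \tau \rrbracket \sim \theta_f)$; $\mathsf{ish2adjl}\, f :\equiv \sum_{g, \eta, \varepsilon} \sum_{\tau : f[\eta] \sim \varepsilon_f} \sum_{\theta : \eta_g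 \sim g[\varepsilon]} (\tau_g \cdot \mathsf{Coh}\, \varepsilon \sim f\llbracket \theta \rrbracket)$. -}

{-# OPTIONS --without-K #-}
module Defs where

open import Level using (Level; _⊔_)
open import Function using (_∘_; id)
open import Data.Product using (Σ; Σ-syntax)
open import Relation.Binary.PropositionalEquality
  using (_≡_; refl; sym; trans; cong)

private
  variable
    a b c : Level

infix 4 _∼_
_∼_ : {A : Set a} {P : A → Set b} (f g : (x : A) → P x) → Set (a ⊔ b)
f ∼ g = ∀ x → f x ≡ g x

infixr 5 _·_
_·_ : {A : Set a} {P : A → Set b} {f g h : (x : A) → P x} → f ∼ g → g ∼ h → f ∼ h
(H · H') x = trans (H x) (H' x)

ap : {A : Set a} {B : Set b} (f : A → B) {x y : A} → x ≡ y → f x ≡ f y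
ap f refl = refl

ap² : {A : Set a} {B : Set b} (f : A → B) {x y : A} {p q : x ≡ y} → p ≡ q → ap f p ≡ ap f q
ap² f α = ap (ap f) α

ap-id : {A : Set a} {x y : A} (p : x ≡ y) → ap id p ≡ p
ap-id refl = refl

ap-∘ : {A : Set a} {B : Set b} {C : Set c} (k : B → C) (h : A → B) {x y : A} (p : x ≡ y)
     → ap (k ∘ h) p ≡ ap k (ap h p)
ap-∘ k h refl = refl

naturality : {A : Set a} {B : Set b} {f g : A → B} (H : f ∼ g) {u v : A} (p : u ≡ v)
           → trans (H u) (ap g p) ≡ trans (ap f p) (H v)
naturality H {u} refl = trans-reflʳ (H u)
  where
  trans-reflʳ : ∀ {ℓ} {X : Set ℓ} {x y : X} (q : x ≡ y) → trans q refl ≡ q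
  trans-reflʳ refl = refl

cancelʳ : {A : Set a} {x y z : A} {r s : x ≡ y} (p : y ≡ z) → trans r p ≡ trans s p → r ≡ s
cancelʳ {r = r} {s = s} refl e = trans (sym (tr r)) (trans e (tr s))
  where
  tr : ∀ {ℓ} {X : Set ℓ} {x y : X} (q : x ≡ y) → trans q refl ≡ q
  tr refl = refl

-- The naturality path  H_{khx} = (kh)[H_x]  for  H : kh ∼ id :
-- naturality of H along H_x gives  H_{khx} · id[H_x] = (kh)[H_x] · H_x ;
-- rewrite id[H_x] = H_x and cancel H_x on the right.
natPath : {X : Set a} {Y : Set b} (h : X → Y) (k : Y → X) (H : (k ∘ h) ∼ id) (x : X)
        → H (k (h x)) ≡ ap (k ∘ h) (H x)
natPath h k H x =
  cancelʳ (H x) (trans (sym (cong (trans (H (k (h x)))) (ap-id (H x)))) (naturality H (H x)))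

Coh : {X : Set a} {Y : Set b} {h : X → Y} {k : Y → X} (H : (k ∘ h) ∼ id)
    → (λ x → H (k (h x))) ∼ (λ x → ap k (ap h (H x)))
Coh {h = h} {k = k} H x = trans (natPath h k H x) (ap-∘ k h (H x))

ish2adj : {A : Set a} {B : Set b} (f : A → B) → Set (a ⊔ b)
ish2adj {A = A} {B = B} f =
  Σ[ g ∈ (B → A) ] Σ[ η ∈ (g ∘ f) ∼ id ] Σ[ ε ∈ (f ∘ g) ∼ id ]
  Σ[ τ ∈ (λ a → ap f (η a)) ∼ (λ a → ε (f a)) ]
  Σ[ θ ∈ (λ b → η (g b)) ∼ (λ b → ap g (ε b)) ]
    ((Coh {h = f} {k = g} η · (λ a → ap² g (τ a))) ∼ (λ a → θ (f a)))

ish2adjl : {A : Set a} {B : Set b} (f : A → B) → Set (a ⊔ b)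
ish2adjl {A = A} {B = B} f =
  Σ[ g ∈ (B → A) ] Σ[ η ∈ (g ∘ f) ∼ id ] Σ[ ε ∈ (f ∘ g) ∼ id ]
  Σ[ τ ∈ (λ a → ap f (η a)) ∼ (λ a → ε (f a)) ]
  Σ[ θ ∈ (λ b → η (g b)) ∼ (λ b → ap g (ε b)) ]
    (((λ b → τ (g b)) · Coh {h = g} {k = f} ε) ∼ (λ b → ap² f (θ b)))

{-# OPTIONS --without-K #-}
module Submission where

-- If h is quasi-invertible then so is ap h, hence so is ap (ap h): every 2-path
-- h[p] = h[q] is h⟦α⟧ for some α : p = q.  Each direction keeps g, η, ε and one of τ, θ,
-- discards the other together with the coherence, and defines the missing 2-homotopy
-- pointwise as the lift along f⟦-⟧ (resp. g⟦-⟧) of the 2-path the target coherence prescribes.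

open import Defs
open import Level using (_⊔_)
open import Data.Product using (Σ-syntax; _×_; _,_; proj₁; proj₂)
open import Function using (_∘_; id)
open import Relation.Binary.PropositionalEquality using (_≡_; refl; sym; trans; cong)
open import Relation.Binary.PropositionalEquality.Properties using (trans-symˡ; trans-symʳ)

QInv : ∀ {a b} {X : Set a} {Y : Set b} → (X → Y) → Set (a ⊔ b)
QInv {X = X} {Y} h = Σ[ k ∈ (Y → X) ] ((k ∘ h) ∼ id) × ((h ∘ k) ∼ id)

trans-cancel-conjugate : ∀ {a} {X : Set a} {u v w z : X} (p : u ≡ v) (m : u ≡ w) (q : w ≡ z)
                       → trans p (trans (trans (sym p) (trans m q)) (sym q)) ≡ m
trans-cancel-conjugate refl refl refl = refl

trans-cancelˡ : ∀ {a} {X : Set a} {u v w : X} (p : u ≡ v) (q : u ≡ w) → trans p (trans (sym p) q) ≡ q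
trans-cancelˡ refl refl = refl

ap-conjugate : ∀ {a} {X : Set a} {F : X → X} (η : F ∼ id) {u v : X} (p : u ≡ v)
             → ap F p ≡ trans (η u) (trans p (sym (η v)))
ap-conjugate η {u} refl = sym (trans-symʳ (η u))

module _ {a b} {X : Set a} {Y : Set b} (h : X → Y) (k : Y → X) where

  unap : (k ∘ h) ∼ id → ∀ {x y} → h x ≡ h y → x ≡ y
  unap η {x} {y} q = trans (sym (η x)) (trans (ap k q) (η y))

  unap-ap : (η : (k ∘ h) ∼ id) → ∀ {x y} (p : x ≡ y) → unap η (ap h p) ≡ p
  unap-ap η {x} refl = trans-symˡ (η x)

module _ {a b} {X : Set a} {Y : Set b} (h : X → Y) (k : Y → X) where
  open Relation.Binary.PropositionalEquality.≡-Reasoning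

  ap-injective : (h ∘ k) ∼ id → ∀ {u v} {q q' : u ≡ v} → ap k q ≡ ap k q' → q ≡ q'
  ap-injective ε {q = q} {q'} e = begin
    q                     ≡⟨ sym (unap-ap k h ε q) ⟩
    unap k h ε (ap k q)   ≡⟨ cong (unap k h ε) e ⟩
    unap k h ε (ap k q')  ≡⟨ unap-ap k h ε q' ⟩
    q'                    ∎

  ap-unap : (η : (k ∘ h) ∼ id) → (h ∘ k) ∼ id → ∀ {x y} (q : h x ≡ h y) → ap h (unap h k η q) ≡ q
  ap-unap η ε {x} {y} q = ap-injective ε (begin
    ap k (ap h (unap h k η q))                      ≡⟨ sym (ap-∘ k h (unap h k η q)) ⟩
    ap (k ∘ h) (unap h k η q)                       ≡⟨ ap-conjugate η (unap h k η q) ⟩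
    trans (η x) (trans (unap h k η q) (sym (η y)))  ≡⟨ trans-cancel-conjugate (η x) (ap k q) (η y) ⟩
    ap k q                                          ∎)

ap-qinv : ∀ {a b} {X : Set a} {Y : Set b} {h : X → Y} → QInv h → ∀ {x y} → QInv (ap h {x} {y})
ap-qinv {h = h} (k , η , ε) = unap h k η , unap-ap h k η , ap-unap h k η ε

ap²-lift : ∀ {a b} {X : Set a} {Y : Set b} {h : X → Y} → QInv h
         → ∀ {x y} {p q : x ≡ y} (r : ap h p ≡ ap h q) → Σ[ α ∈ p ≡ q ] ap² h α ≡ r
ap²-lift qinv r with ap-qinv (ap-qinv qinv)
... | (lift , _ , lift-section) = lift r , lift-section r

module _ {a b} {A : Set a} {B : Set b} (f : A → B) where

  ish2adj→ish2adjl : ish2adj f → ish2adjl f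
  ish2adj→ish2adjl (g , η , ε , τ , _ , _) = g , η , ε , τ , θ , λ b → sym (proj₂ (lift b))
    where
    cohε : (λ b → ε (f (g b))) ∼ (λ b → ap f (ap g (ε b)))
    cohε = Coh {h = g} {k = f} ε
    lift : ∀ b → Σ[ α ∈ η (g b) ≡ ap g (ε b) ] ap² f α ≡ trans (τ (g b)) (cohε b)
    lift b = ap²-lift (g , η , ε) (trans (τ (g b)) (cohε b))
    θ : (λ b → η (g b)) ∼ (λ b → ap g (ε b))
    θ b = proj₁ (lift b)

  ish2adjl→ish2adj : ish2adjl f → ish2adj f
  ish2adjl→ish2adj (g , η , ε , _ , θ , _) = g , η , ε , τ , θ , coherence
    where
    cohη : (λ a → η (g (f a))) ∼ (λ a → ap g (ap f (η a)))
    cohη = Coh {h = f} {k = g} η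
    lift : ∀ a → Σ[ α ∈ ap f (η a) ≡ ε (f a) ] ap² g α ≡ trans (sym (cohη a)) (θ (f a))
    lift a = ap²-lift (f , ε , η) (trans (sym (cohη a)) (θ (f a)))
    τ : (λ a → ap f (η a)) ∼ (λ a → ε (f a))
    τ a = proj₁ (lift a)
    coherence : (cohη · (λ a → ap² g (τ a))) ∼ (λ a → θ (f a))
    coherence a = trans (cong (trans (cohη a)) (proj₂ (lift a))) (trans-cancelˡ (cohη a) (θ (f a)))

theorem3p11 : ∀ {a b} {A : Set a} {B : Set b} (f : A → B)
            → (ish2adj f → ish2adjl f) × (ish2adjl f → ish2adj f)
theorem3p11 f = ish2adj→ish2adjl f , ish2adjl→ish2adj f
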